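{- Let $P$ be a poset on $\{1,\ldots,n\}$ and let $M$ be a maximum independent set of $G_P$. Then $i\in\mathrm{Des}(M)$ if and only if there exists $j<i$ such that $J_i\prec_M J_j$, where $J_i,J_j\in M$ are the elements with $J_i\setminus\mu(M,J_i)=\{i\}$ and $J_j\setminus\mu(M,J_j)=\{j\}$.
   Context: An order ideal of $P$ is a subset $J$ with $i\in J$, $j\le_P i\Rightarrow j\in J$; a nonempty order ideal is connected if the Hasse diagram of $P$ restricted to it is connected. Sets $A,B$ intersect nontrivially if $A\cap B\ne\emptyset$, $A\not\subseteq B$, $B\not\subseteq A$. $G_P$ is the simple graph whose vertices are the connected order ideals of $P$, adjacent iff they intersect nontrivially. A maximum independent set is an independent set of largest possible size. For $J\in M$, $\mu(M,J)=\bigcup_{J'\in M,\,J'\subsetneq J}J'$; each $J\setminus\mu(M,J)$ is a singleton and distinct $J$ give distinct singletons covering $[n]$ (fact from the paper), so $J_i$ is well defined for each $i\in[n]$. $F_M$ is the poset on $[n]$ with $i<_{F_M}j$ iff $J_i\subsetneq J_j$; it is a forest (each element covered by at most one element, its parent). $\mathrm{Des}(M)$ is the set of $i$ whose parent $j$ in $F_M$ satisfies $i>j$. For $J_a,J_b\in M$, $J_a\prec_M J_b$ means $J_a\subsetneq J_b$ and there is no $J\in M$ with $J_a\subsetneq J\subsetneq J_b$. -}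

module Defs where

open import Level using (0ℓ)
open import Data.Nat using (ℕ)
open import Data.Fin using (Fin) renaming (_<_ to _<F_)
open import Data.Fin.Subset using (Subset; _∈_; _∉_; _⊆_; _⊂_; _∩_; Nonempty)
open import Data.List using (List; length)
open import Data.List.Membership.Propositional renaming (_∈_ to _∈L_)
open import Data.List.Relation.Unary.Unique.Propositional using (Unique)
open import Data.Product using (Σ; ∃; _×_; _,_)
open import Data.Sum using (_⊎_)
open import Relation.Nullary using (¬_)
open import Relation.Binary using (Rel; IsPartialOrder)
open import Relation.Binary.PropositionalEquality using (_≡_; _≢_)

IsPosetOn : (n : ℕ) → Rel (Fin n) 0ℓ → Set
IsPosetOn n _≤P_ = IsPartialOrder _≡_ _≤P_

IntersectNontrivially : ∀ {n} → Subset n → Subset n → Set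
IntersectNontrivially A B = Nonempty (A ∩ B) × ¬ (A ⊆ B) × ¬ (B ⊆ A)

module _ {n : ℕ} (_≤P_ : Rel (Fin n) 0ℓ) where

  StrictP : Fin n → Fin n → Set
  StrictP a b = (a ≤P b) × (a ≢ b)

  Covers : Fin n → Fin n → Set
  Covers a b = StrictP a b × (¬ (∃ λ c → StrictP a c × StrictP c b))

  IsOrderIdeal : Subset n → Set
  IsOrderIdeal J = ∀ i j → i ∈ J → j ≤P i → j ∈ J

  data HasseReach (J : Subset n) : Fin n → Fin n → Set where
    here : ∀ {a} → HasseReach J a a
    step : ∀ {a b c} → b ∈ J → (Covers a b ⊎ Covers b a) →
           HasseReach J b c → HasseReach J a c

  IsConnectedOrderIdeal : Subset n → Set
  IsConnectedOrderIdeal J =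
    IsOrderIdeal J × Nonempty J ×
    (∀ a b → a ∈ J → b ∈ J → HasseReach J a b)

  -- independent set of G_P (a finite set of vertices, as a duplicate-free list)
  IsIndependent : List (Subset n) → Set
  IsIndependent M =
    Unique M × (∀ J → J ∈L M → IsConnectedOrderIdeal J) ×
    (∀ A B → A ∈L M → B ∈L M → ¬ IntersectNontrivially A B)

  IsMaximumIndependent : List (Subset n) → Set
  IsMaximumIndependent M =
    IsIndependent M × (∀ M' → IsIndependent M' → length M' Data.Nat.≤ length M)

module _ {n : ℕ} (M : List (Subset n)) where

  -- x ∈ μ(M,J) = ⋃ { J' ∈ M | J' ⊊ J }
  InMu : Subset n → Fin n → Set
  InMu J x = ∃ λ J' → J' ∈L M × J' ⊂ J × x ∈ J'

  -- J ∈ M and J ∖ μ(M,J) = {i}, i.e. J is the set J_i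
  IsJ : Fin n → Subset n → Set
  IsJ i J = J ∈L M × i ∈ J × ¬ InMu J i × (∀ x → x ∈ J → ¬ InMu J x → x ≡ i)

  CoveredIn : Subset n → Subset n → Set
  CoveredIn Ja Jb = Ja ⊂ Jb × ¬ (∃ λ J → J ∈L M × Ja ⊂ J × J ⊂ Jb)

  -- strict order of the forest F_M: i <_F j iff J_i ⊊ J_j
  LtF : Fin n → Fin n → Set
  LtF i j = ∃ λ Ji → ∃ λ Jj → IsJ i Ji × IsJ j Jj × Ji ⊂ Jj

  IsParent : Fin n → Fin n → Set
  IsParent j i = LtF i j × ¬ (∃ λ k → LtF i k × LtF k j)

  InDes : Fin n → Set
  InDes i = ∃ λ j → IsParent j i × j <F i

-- Members of an independent set M pairwise either are disjoint or nested, so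
-- each J ∈ M is the disjoint union of μ(M,J) and J ∖ μ(M,J).  That the latter
-- is nonempty follows from the connectivity of J: a largest proper submember
-- containing a fixed point could otherwise be enlarged across a Hasse edge
-- leaving it.  That it has at most one element follows from maximality: if
-- x, y ∈ J ∖ μ(M,J) with y ≰ x, the component of x in μ(M,J) ∪ ↓x is a
-- connected order ideal which could be added to M.  With J_i thus well
-- defined and unique, "j is the parent of i in F_M" says precisely that
-- J_i ≺_M J_j.
module Submission where

open import Defs
open import Level using (0ℓ)
open import Data.Nat using (ℕ; zero; suc; _<_)
open import Data.Nat.Induction using (<-wellFounded)
open import Data.Nat.Properties using (1+n≰n)
open import Data.Fin using (Fin; zero; suc) renaming (_<_ to _<F_)
open import Data.Fin.Properties using (any?; _≟_)
open import Data.Fin.Subset using (Subset; _∈_; _∉_; _⊆_; _⊂_; ∣_∣; ∁)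
open import Data.Fin.Subset.Properties
  using (_∈?_; _⊆?_; _⊂?_; ⊆-antisym; p⊂q⇒p⊆q; p⊂q⇒∣p∣<∣q∣; p⊂q⇒∁p⊃∁q; x∈p∩q⁺; x∈p∩q⁻)
open import Data.List using (List; _∷_)
open import Data.List.Membership.Propositional using (find; lose) renaming (_∈_ to _∈L_)
open import Data.List.Relation.Unary.Any using (here; there) renaming (any? to anyL?)
open import Data.List.Relation.Unary.All as All using ()
open import Data.List.Relation.Unary.AllPairs using (_∷_)
open import Data.Vec using (tabulate)
open import Data.Vec.Properties using (lookup∘tabulate; []=⇒lookup; lookup⇒[]=)
open import Data.Product using (∃; _×_; _,_; proj₁; proj₂) renaming (swap to ×-swap)
open import Data.Sum using (_⊎_; inj₁; inj₂; swap)
open import Data.Empty using (⊥; ⊥-elim)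
open import Function using (_∘_)
open import Function.Bundles using (_⇔_; mk⇔)
open import Induction.WellFounded using (Acc; acc)
open import Relation.Nullary using (¬_; yes; no; does; ¬¬-map)
open import Relation.Nullary.Decidable
  using (_×-dec_; _⊎-dec_; ¬?; map′; dec-true; decidable-stable; ¬¬-excluded-middle)
open import Relation.Unary using (Decidable)
import Relation.Binary.Definitions as B
open import Relation.Binary using (Rel; IsPartialOrder)
open import Relation.Binary.PropositionalEquality using (_≡_; _≢_; refl; sym; trans; subst)

¬¬-Π : ∀ {m} {P : Fin m → Set} → (∀ x → ¬ ¬ P x) → ¬ ¬ (∀ x → P x)
¬¬-Π {zero}  _ k = k λ ()
¬¬-Π {suc m} h k = h zero λ p₀ → ¬¬-Π (h ∘ suc) λ ps → k λ { zero → p₀ ; (suc x) → ps x }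

¬¬-decidable : ∀ {m} (P : Fin m → Set) → ¬ ¬ Decidable P
¬¬-decidable P = ¬¬-Π λ _ → ¬¬-excluded-middle

¬¬-decidable₂ : ∀ {m} (R : Rel (Fin m) 0ℓ) → ¬ ¬ B.Decidable R
¬¬-decidable₂ R = ¬¬-Π λ x → ¬¬-decidable (R x)

subset : ∀ {m} {P : Fin m → Set} → Decidable P → Subset m
subset P? = tabulate (does ∘ P?)

module _ {m : ℕ} {P : Fin m → Set} (P? : Decidable P) {x : Fin m} where

  ∈-subset⁺ : P x → x ∈ subset P?
  ∈-subset⁺ p = lookup⇒[]= x _ (trans (lookup∘tabulate (does ∘ P?) x) (dec-true (P? x) p))

  ∈-subset⁻ : x ∈ subset P? → P x
  ∈-subset⁻ x∈ with P? x | trans (sym (lookup∘tabulate (does ∘ P?) x)) ([]=⇒lookup x∈)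
  ... | yes p | _ = p
  ... | no _  | ()

⊆∧⊈⇒⊂ : ∀ {m} {p q : Subset m} → p ⊆ q → ¬ q ⊆ p → p ⊂ q
⊆∧⊈⇒⊂ {p = p} {q} p⊆q q⊈p with any? (λ x → x ∈? q ×-dec ¬? (x ∈? p))
... | yes witness = p⊆q , witness
... | no none     =
  ⊥-elim (q⊈p λ {x} x∈q → decidable-stable (x ∈? p) λ x∉p → none (x , x∈q , x∉p))

⊂-unbounded⇒⊥ : ∀ {m} {P : Subset m → Set} →
                (∀ {p} → P p → ∃ λ q → P q × p ⊂ q) → ∀ {p} → ¬ P p
⊂-unbounded⇒⊥ {P = P} grow = go (<-wellFounded _)
  where
  go : ∀ {p} → Acc _<_ ∣ ∁ p ∣ → ¬ P p
  go (acc rs) Pp with grow Pp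
  ... | q , Pq , p⊂q = go (rs (p⊂q⇒∣p∣<∣q∣ (p⊂q⇒∁p⊃∁q p⊂q))) Pq

IntersectNontrivially-sym : ∀ {n} {A B : Subset n} →
                            IntersectNontrivially A B → IntersectNontrivially B A
IntersectNontrivially-sym {A = A} {B} ((z , z∈A∩B) , A⊈B , B⊈A) =
  (z , x∈p∩q⁺ (×-swap (x∈p∩q⁻ A B z∈A∩B))) , B⊈A , A⊈B

module HassePaths {n : ℕ} (_≤P_ : Rel (Fin n) 0ℓ) where

  HasseReach-trans : ∀ {J a b c} → HasseReach _≤P_ J a b → HasseReach _≤P_ J b c →
                     HasseReach _≤P_ J a c
  HasseReach-trans here            q = q
  HasseReach-trans (step b∈J e p) q = step b∈J e (HasseReach-trans p q)

  HasseReach-sym : ∀ {J a b} → a ∈ J → HasseReach _≤P_ J a b → HasseReach _≤P_ J b a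
  HasseReach-sym a∈J here            = here
  HasseReach-sym a∈J (step b∈J e p) = HasseReach-trans (HasseReach-sym b∈J p) (step a∈J (swap e) here)

  HasseReach-mono : ∀ {J T a b} → J ⊆ T → HasseReach _≤P_ J a b → HasseReach _≤P_ T a b
  HasseReach-mono J⊆T here            = here
  HasseReach-mono J⊆T (step b∈J e p) = step (J⊆T b∈J) e (HasseReach-mono J⊆T p)

  HasseReach-crossing : ∀ {T a b} (J : Subset n) → HasseReach _≤P_ T a b → a ∈ J → b ∉ J →
    ∃ λ u → ∃ λ v → u ∈ J × v ∉ J × v ∈ T × (Covers _≤P_ u v ⊎ Covers _≤P_ v u)
  HasseReach-crossing J here a∈J a∉J = ⊥-elim (a∉J a∈J)
  HasseReach-crossing {a = a} J (step {b = b} b∈T e p) a∈J c∉J with b ∈? J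
  ... | yes b∈J = HasseReach-crossing J p b∈J c∉J
  ... | no b∉J  = a , b , a∈J , b∉J , b∈T , e

  Covers⇒≤ : ∀ {a b} → Covers _≤P_ a b → a ≤P b
  Covers⇒≤ ((a≤b , _) , _) = a≤b

module SaturatedChains {n : ℕ} {_≤P_ : Rel (Fin n) 0ℓ} (po : IsPartialOrder _≡_ _≤P_)
                       (_≤?_ : B.Decidable _≤P_) where
  open HassePaths _≤P_
  open IsPartialOrder po using (antisym) renaming (refl to ≤-refl; trans to ≤-trans)

  interval : Fin n → Fin n → Subset n
  interval w z = subset λ c → w ≤? c ×-dec c ≤? z

  ∈-interval⁺ : ∀ {w c z} → w ≤P c → c ≤P z → c ∈ interval w z
  ∈-interval⁺ w≤c c≤z = ∈-subset⁺ (λ c → _ ≤? c ×-dec c ≤? _) (w≤c , c≤z)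

  ∈-interval⁻ : ∀ {w c z} → c ∈ interval w z → w ≤P c × c ≤P z
  ∈-interval⁻ = ∈-subset⁻ (λ c → _ ≤? c ×-dec c ≤? _)

  interval-shrinksʳ : ∀ {w c z} → w ≤P c → c ≤P z → c ≢ z → interval w c ⊂ interval w z
  interval-shrinksʳ w≤c c≤z c≢z =
    (λ d∈ → let w≤d , d≤c = ∈-interval⁻ d∈ in ∈-interval⁺ w≤d (≤-trans d≤c c≤z)) ,
    _ , ∈-interval⁺ (≤-trans w≤c c≤z) ≤-refl ,
    λ z∈ → c≢z (antisym c≤z (proj₂ (∈-interval⁻ z∈)))

  interval-shrinksˡ : ∀ {w c z} → w ≤P c → c ≤P z → w ≢ c → interval c z ⊂ interval w z
  interval-shrinksˡ w≤c c≤z w≢c =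
    (λ d∈ → let c≤d , d≤z = ∈-interval⁻ d∈ in ∈-interval⁺ (≤-trans w≤c c≤d) d≤z) ,
    _ , ∈-interval⁺ ≤-refl (≤-trans w≤c c≤z) ,
    λ w∈ → w≢c (antisym w≤c (proj₁ (∈-interval⁻ w∈)))

  strict? : B.Decidable (StrictP _≤P_)
  strict? a b = a ≤? b ×-dec ¬? (a ≟ b)

  ≤⇒HasseReach : ∀ {T w z} → IsOrderIdeal _≤P_ T → w ≤P z → z ∈ T → HasseReach _≤P_ T w z
  ≤⇒HasseReach {T} T-ideal = go (<-wellFounded _)
    where
    go : ∀ {w z} → Acc _<_ ∣ interval w z ∣ → w ≤P z → z ∈ T → HasseReach _≤P_ T w z
    go {w} {z} (acc rs) w≤z z∈T with w ≟ z
    ... | yes refl = here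
    ... | no w≢z with any? (λ c → strict? w c ×-dec strict? c z)
    ...   | no nothing-between = step z∈T (inj₁ ((w≤z , w≢z) , nothing-between)) here
    ...   | yes (c , (w≤c , w≢c) , (c≤z , c≢z)) =
      HasseReach-trans
        (go (rs (p⊂q⇒∣p∣<∣q∣ (interval-shrinksʳ w≤c c≤z c≢z))) w≤c (T-ideal z c z∈T c≤z))
        (go (rs (p⊂q⇒∣p∣<∣q∣ (interval-shrinksˡ w≤c c≤z w≢c))) c≤z z∈T)

module Component {n : ℕ} {_≤P_ : Rel (Fin n) 0ℓ} (po : IsPartialOrder _≡_ _≤P_)
                 (_≤?_ : B.Decidable _≤P_) {S : Subset n} {x : Fin n} (x∈S : x ∈ S)
                 (reach? : Decidable (HasseReach _≤P_ S x)) where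
  open HassePaths _≤P_
  open SaturatedChains po _≤?_

  component : Subset n
  component = subset reach?

  x∈component : x ∈ component
  x∈component = ∈-subset⁺ reach? here

  component⊆S : component ⊆ S
  component⊆S z∈ = HasseReach-∈ x∈S (∈-subset⁻ reach? z∈)
    where
    HasseReach-∈ : ∀ {a b} → a ∈ S → HasseReach _≤P_ S a b → b ∈ S
    HasseReach-∈ a∈S here           = a∈S
    HasseReach-∈ a∈S (step b∈S _ p) = HasseReach-∈ b∈S p

  component-closed : ∀ {a b} → a ∈ component → HasseReach _≤P_ S a b → b ∈ component
  component-closed a∈ p = ∈-subset⁺ reach? (HasseReach-trans (∈-subset⁻ reach? a∈) p)

  HasseReach-component : ∀ {a b} → a ∈ component → HasseReach _≤P_ S a b →
                         HasseReach _≤P_ component a b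
  HasseReach-component a∈ here = here
  HasseReach-component a∈ (step b∈S e p) = step b∈ e (HasseReach-component b∈ p)
    where b∈ = component-closed a∈ (step b∈S e here)

  component-coi : IsOrderIdeal _≤P_ S → IsConnectedOrderIdeal _≤P_ component
  component-coi S-ideal = ideal , (x , x∈component) , connected
    where
    ideal : IsOrderIdeal _≤P_ component
    ideal z w z∈ w≤z = component-closed z∈
      (HasseReach-sym (S-ideal z w z∈S w≤z) (≤⇒HasseReach S-ideal w≤z z∈S))
      where z∈S = component⊆S z∈
    connected : ∀ a b → a ∈ component → b ∈ component → HasseReach _≤P_ component a b
    connected a b a∈ b∈ = HasseReach-component a∈
      (HasseReach-trans (HasseReach-sym x∈S (∈-subset⁻ reach? a∈)) (∈-subset⁻ reach? b∈))

  component-absorbs : ∀ {A z} → A ⊆ S → (∀ a b → a ∈ A → b ∈ A → HasseReach _≤P_ A a b) →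
                      z ∈ A → z ∈ component → A ⊆ component
  component-absorbs A⊆S A-connected z∈A z∈ a∈A =
    component-closed z∈ (HasseReach-mono A⊆S (A-connected _ _ z∈A a∈A))

module _ {n : ℕ} (M : List (Subset n)) where

  InMu? : ∀ J → Decidable (InMu M J)
  InMu? J x = map′ find (λ (J' , J'∈M , h) → lose J'∈M h) (anyL? (λ J' → J' ⊂? J ×-dec x ∈? J') M)

  InMu⇒∈ : ∀ {J x} → InMu M J x → x ∈ J
  InMu⇒∈ (_ , _ , (J'⊆J , _) , x∈J') = J'⊆J x∈J'

  Uncovered : Subset n → Fin n → Set
  Uncovered J x = x ∈ J × ¬ InMu M J x

  CoveredBySmallerLabel : Fin n → Set
  CoveredBySmallerLabel i =
    ∃ λ j → j <F i × (∃ λ Ji → ∃ λ Jj → IsJ M i Ji × IsJ M j Jj × CoveredIn M Ji Jj)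

module Independent {n : ℕ} {_≤P_ : Rel (Fin n) 0ℓ} {M : List (Subset n)}
                   (indM : IsIndependent _≤P_ M) where
  open HassePaths _≤P_

  private
    member-coi : ∀ {J} → J ∈L M → IsConnectedOrderIdeal _≤P_ J
    member-coi = proj₁ (proj₂ indM) _

  member-ideal : ∀ {J} → J ∈L M → IsOrderIdeal _≤P_ J
  member-ideal = proj₁ ∘ member-coi

  member-connected : ∀ {J} → J ∈L M → ∀ a b → a ∈ J → b ∈ J → HasseReach _≤P_ J a b
  member-connected = proj₂ ∘ proj₂ ∘ member-coi

  nested : ∀ {A B x} → A ∈L M → B ∈L M → x ∈ A → x ∈ B → A ⊆ B ⊎ B ⊂ A
  nested {A} {B} {x} A∈M B∈M x∈A x∈B with A ⊆? B | B ⊆? A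
  ... | yes A⊆B | _       = inj₁ A⊆B
  ... | no A⊈B  | yes B⊆A = inj₂ (⊆∧⊈⇒⊂ B⊆A A⊈B)
  ... | no A⊈B  | no B⊈A  =
    ⊥-elim (proj₂ (proj₂ indM) A B A∈M B∈M ((x , x∈p∩q⁺ (x∈A , x∈B)) , A⊈B , B⊈A))

  IsJ-unique : ∀ {i J J'} → IsJ M i J → IsJ M i J' → J ≡ J'
  IsJ-unique (J∈M , i∈J , i∉μJ , _) (J'∈M , i∈J' , i∉μJ' , _)
    with nested J∈M J'∈M i∈J i∈J' | nested J'∈M J∈M i∈J' i∈J
  ... | inj₂ J'⊂J | _         = ⊥-elim (i∉μJ (_ , J'∈M , J'⊂J , i∈J'))
  ... | _         | inj₂ J⊂J' = ⊥-elim (i∉μJ' (_ , J∈M , J⊂J' , i∈J))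
  ... | inj₁ J⊆J' | inj₁ J'⊆J = ⊆-antisym J⊆J' J'⊆J

  ⊈μ : ∀ {J} → J ∈L M → ¬ (∀ {x} → x ∈ J → InMu M J x)
  ⊈μ {J} J∈M J⊆μ with proj₁ (proj₂ (member-coi J∈M))
  ... | a , a∈J with J⊆μ a∈J
  ... | _ , J₀∈M , J₀⊂J , a∈J₀ = ⊂-unbounded⇒⊥ grow (J₀∈M , J₀⊂J , a∈J₀)
    where
    grow : ∀ {J'} → J' ∈L M × J' ⊂ J × a ∈ J' →
           ∃ λ J'' → (J'' ∈L M × J'' ⊂ J × a ∈ J'') × J' ⊂ J''
    grow (J'∈M , (_ , b , b∈J , b∉J') , a∈J')
      with HasseReach-crossing _ (member-connected J∈M a b a∈J b∈J) a∈J' b∉J'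
    ... | u , v , u∈J' , v∉J' , v∈J , edge with J⊆μ v∈J
    ... | J'' , J''∈M , J''⊂J , v∈J'' with edge
    ... | inj₂ v⋖u = ⊥-elim (v∉J' (member-ideal J'∈M u v u∈J' (Covers⇒≤ v⋖u)))
    ... | inj₁ u⋖v with nested J''∈M J'∈M (member-ideal J''∈M v u v∈J'' (Covers⇒≤ u⋖v)) u∈J'
    ...   | inj₁ J''⊆J' = ⊥-elim (v∉J' (J''⊆J' v∈J''))
    ...   | inj₂ J'⊂J'' = J'' , (J''∈M , J''⊂J , p⊂q⇒p⊆q J'⊂J'' a∈J') , J'⊂J''

  uncovered-exists : ∀ {J} → J ∈L M → ∃ (Uncovered M J)
  uncovered-exists {J} J∈M with any? (λ x → x ∈? J ×-dec ¬? (InMu? M J x))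
  ... | yes found = found
  ... | no none   =
    ⊥-elim (⊈μ J∈M λ {x} x∈J → decidable-stable (InMu? M J x) λ x∉μ → none (x , x∈J , x∉μ))

  ∷-independent : ∀ {K} → IsConnectedOrderIdeal _≤P_ K → ¬ K ∈L M →
                  (∀ {A} → A ∈L M → ¬ IntersectNontrivially K A) → IsIndependent _≤P_ (K ∷ M)
  ∷-independent K-coi K∉M K-compatible =
    All.tabulate (λ A∈M K≡A → K∉M (subst (_∈L M) (sym K≡A) A∈M)) ∷ proj₁ indM ,
    (λ { _ (here refl) → K-coi ; A (there A∈M) → proj₁ (proj₂ indM) A A∈M }) ,
    λ { _ _ (here refl) (here refl) (_ , K⊈K , _) → K⊈K λ k → k
      ; _ _ (here refl) (there B∈M) → K-compatible B∈M
      ; _ _ (there A∈M) (here refl) → K-compatible A∈M ∘ IntersectNontrivially-sym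
      ; A B (there A∈M) (there B∈M) → proj₂ (proj₂ indM) A B A∈M B∈M }

  covered⇒InDes : ∀ {i} → CoveredBySmallerLabel M i → InDes M i
  covered⇒InDes (j , j<i , Ji , Jj , Ji-i , Jj-j , Ji⊂Jj , nothing-between) =
    j , ((Ji , Jj , Ji-i , Jj-j , Ji⊂Jj) , no-middle) , j<i
    where
    no-middle : ¬ (∃ λ k → LtF M _ k × LtF M k j)
    no-middle (k , (Ji' , Jk , Ji'-i , Jk-k , Ji'⊂Jk) , (Jk' , Jj' , Jk'-k , Jj'-j , Jk'⊂Jj'))
      with IsJ-unique Ji-i Ji'-i | IsJ-unique Jk-k Jk'-k | IsJ-unique Jj-j Jj'-j
    ... | refl | refl | refl = nothing-between (Jk , proj₁ Jk-k , Ji'⊂Jk , Jk'⊂Jj')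

module Maximum {n : ℕ} {_≤P_ : Rel (Fin n) 0ℓ} (po : IsPartialOrder _≡_ _≤P_)
               {M : List (Subset n)} (maxM : IsMaximumIndependent _≤P_ M) where
  open Independent (proj₁ maxM)
  open IsPartialOrder po using (antisym) renaming (trans to ≤-trans)

  nonextendable : ∀ {K} → IsConnectedOrderIdeal _≤P_ K → ¬ K ∈L M →
                  (∀ {A} → A ∈L M → ¬ IntersectNontrivially K A) → ⊥
  nonextendable K-coi K∉M K-compatible =
    1+n≰n (proj₂ maxM _ (∷-independent K-coi K∉M K-compatible))

  module _ (_≤?_ : B.Decidable _≤P_) {J} (J∈M : J ∈L M) {x y}
           (x∈J : x ∈ J) (x∉μ : ¬ InMu M J x) (y∈J : y ∈ J) (y∉μ : ¬ InMu M J y) where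

    S? : Decidable λ z → InMu M J z ⊎ z ≤P x
    S? z = InMu? M J z ⊎-dec z ≤? x

    S : Subset n
    S = subset S?

    x∈S : x ∈ S
    x∈S = ∈-subset⁺ S? (inj₂ (IsPartialOrder.refl po))

    S⊆J : S ⊆ J
    S⊆J z∈S with ∈-subset⁻ S? z∈S
    ... | inj₁ z∈μ = InMu⇒∈ M z∈μ
    ... | inj₂ z≤x = member-ideal J∈M _ _ x∈J z≤x

    S-ideal : IsOrderIdeal _≤P_ S
    S-ideal z w z∈S w≤z with ∈-subset⁻ S? z∈S
    ... | inj₁ (J' , J'∈M , J'⊂J , z∈J') =
      ∈-subset⁺ S? (inj₁ (J' , J'∈M , J'⊂J , member-ideal J'∈M z w z∈J' w≤z))
    ... | inj₂ z≤x                       = ∈-subset⁺ S? (inj₂ (≤-trans w≤z z≤x))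

    module _ (y≰x : ¬ y ≤P x) (reach? : Decidable (HasseReach _≤P_ S x)) where
      open Component po _≤?_ x∈S reach?

      y∉component : y ∉ component
      y∉component y∈ with ∈-subset⁻ S? (component⊆S y∈)
      ... | inj₁ y∈μ = y∉μ y∈μ
      ... | inj₂ y≤x = y≰x y≤x

      component∉M : ¬ component ∈L M
      component∉M K∈M =
        x∉μ (component , K∈M , (S⊆J ∘ component⊆S , y , y∈J , y∉component) , x∈component)

      component-compatible : ∀ {A} → A ∈L M → ¬ IntersectNontrivially component A
      component-compatible {A} A∈M ((z , z∈K∩A) , K⊈A , A⊈K) with x∈p∩q⁻ component A z∈K∩A
      ... | z∈K , z∈A with nested J∈M A∈M (S⊆J (component⊆S z∈K)) z∈A
      ... | inj₁ J⊆A = K⊈A (J⊆A ∘ S⊆J ∘ component⊆S)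
      ... | inj₂ A⊂J = A⊈K (component-absorbs (λ a∈A → ∈-subset⁺ S? (inj₁ (A , A∈M , A⊂J , a∈A)))
                                               (member-connected A∈M) z∈A z∈K)

    uncovered-≤ : y ≤P x
    uncovered-≤ = decidable-stable (y ≤? x) λ y≰x →
      ¬¬-decidable (HasseReach _≤P_ S x) λ reach? →
        nonextendable (Component.component-coi po _≤?_ x∈S reach? S-ideal)
                      (component∉M y≰x reach?) (component-compatible y≰x reach?)

  -- _≤P_ is not assumed decidable; as x ≡ y is decidable, the decidability of
  -- _≤P_ and of Hasse reachability may be assumed under a double negation.
  uncovered-unique : ∀ {J x y} → J ∈L M → Uncovered M J x → Uncovered M J y → x ≡ y
  uncovered-unique {x = x} {y} J∈M (x∈J , x∉μ) (y∈J , y∉μ) =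
    decidable-stable (x ≟ y) (¬¬-map (λ _≤?_ →
      antisym (uncovered-≤ _≤?_ J∈M y∈J y∉μ x∈J x∉μ)
              (uncovered-≤ _≤?_ J∈M x∈J x∉μ y∈J y∉μ))
      (¬¬-decidable₂ _≤P_))

  IsJ-exists : ∀ {J} → J ∈L M → ∃ λ k → IsJ M k J
  IsJ-exists J∈M with uncovered-exists J∈M
  ... | k , k∈J , k∉μ =
    k , J∈M , k∈J , k∉μ , λ x x∈J x∉μ → uncovered-unique J∈M (x∈J , x∉μ) (k∈J , k∉μ)

  InDes⇒covered : ∀ {i} → InDes M i → CoveredBySmallerLabel M i
  InDes⇒covered (j , ((Ji , Jj , Ji-i , Jj-j , Ji⊂Jj) , no-middle) , j<i) =
    j , j<i , Ji , Jj , Ji-i , Jj-j , Ji⊂Jj ,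
    λ (J , J∈M , Ji⊂J , J⊂Jj) → let k , J-k = IsJ-exists J∈M in
      no-middle (k , (Ji , J , Ji-i , J-k , Ji⊂J) , (J , Jj , J-k , Jj-j , J⊂Jj))

lemma3p5 : (n : ℕ) (_≤P_ : Rel (Fin n) 0ℓ) → IsPosetOn n _≤P_ →
    (M : List (Subset n)) → IsMaximumIndependent _≤P_ M →
    (i : Fin n) →
    InDes M i ⇔
      (∃ λ j → j <F i × (∃ λ Ji → ∃ λ Jj → IsJ M i Ji × IsJ M j Jj × CoveredIn M Ji Jj))
lemma3p5 n _≤P_ po M maxM i = mk⇔ InDes⇒covered (Independent.covered⇒InDes (proj₁ maxM))
  where open Maximum po maxM
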